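{- Let $k\in\mathbb{N}^*$. For every $M\in2\mathrm{NDFA}(k)$ (resp. $M\in2\mathrm{DFA}(k)$) that always halts, there exist $c\in\mathbb{N}$ and $M'\in\mathrm{NDPM}(k+c)$ (resp. $M'\in\mathrm{DPM}(k+c)$) such that $\mathrm{co}\text{ - }\mathcal{L}(M)=\mathcal{L}(M')$, i.e. $M'$ decides the set of integers rejected (not accepted) by $M$.
   Context: Two-way multi-head automata: $M\in2\mathrm{NDFA}(k)$ is a tuple $(S,A,k,\vartriangleright,\vartriangleleft,s_0,F,\sigma)$ with finite state set $S$, alphabet $A=\{0,1\}$, endmarkers $\vartriangleright,\vartriangleleft$, initial state $s_0$, accepting states $F\subseteq S$, and transition relation $\sigma\subseteq(S\times(A\cup\{\vartriangleright,\vartriangleleft\})^k)\times(S\times\{ -1,0,1\}^k)$ never moving a head left of $\vartriangleright$ or right of $\vartriangleleft$. On input $n$ with binary writing $w$, the tape holds $\vartriangleright w\vartriangleleft$, all heads start on $\vartriangleright$ in state $s_0$; $n$ is accepted if some branch reaches a state in $F$ after finitely many transitions; $\mathcal{L}(M)$ is the accepted set and $\mathrm{co}\text{ - }\mathcal{L}(M)$ the rejected set. $M$ always halts if on every input all branches reach, in finitely many steps, a configuration where no transition applies. $M$ is in $2\mathrm{DFA}(k)$ if $\sigma$ is functional. Pointer machines: let $\Sigma=\{0,1,\star\}$ and for pointers $p_1,\dots,p_p$ let the instructions be $p_i+$ (move one step forward), $p_i-$ (one step backward), $\epsilon_i$ (do not move). A non-deterministic pointer machine with $p\in\mathbb{N}^*$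 pointers ($\mathrm{NDPM}(p)$) is $M=(Q,\to)$ with $Q$ a set of states and a total relation $\to\subseteq(\Sigma^p\times Q)\times((I^p\times Q)\cup\{\mathbf{accept},\mathbf{reject}\})$, where $I=\{p_i+,p_i-,\epsilon_i\}$. Elements of $\Sigma^p\times Q$ are pseudo-configurations: the last values read by the pointers (memory slots, updated when a pointer moves) and the current state. On input $n$ with binary writing $a_1\dots a_k$, the circular read-only tape contains $\star a_1\dots a_k$ (with $a_{k+1}=a_0=\star$), all pointers start at address $0$ (on $\star$), and the machine starts from a chosen initial pseudo-configuration $s$ (which need not reflect the actual tape values); this run is $M_s(n)$. $M_s(n)$ accepts if after finitely many transitions every branch reaches $\mathbf{accept}$, and rejects if some branch reaches $\mathbf{reject}$. $M$ decides $S\subseteq\mathbb{N}$ if there is $s$ with $M_s(n)$ accepting iff $n\in S$; $\mathcal{L}(M')$ denotes the set so decided. $M$ is deterministic ($\mathrm{DPM}(p)$) if $\to$ is functional. -}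

module Defs where

open import Data.Nat using (ℕ; zero; suc; _+_; _∸_; _%_; _≤_)
open import Data.Fin using (Fin)
open import Data.Bool using (Bool; true; false)
open import Data.List using (List; []; _∷_; length; reverse)
open import Data.Vec using (Vec; []; _∷_; map; zipWith; replicate; lookup)
open import Data.Maybe using (Maybe; just; nothing)
open import Data.Product using (Σ; ∃; _×_; _,_; proj₁)
open import Relation.Binary.PropositionalEquality using (_≡_; _≢_)
open import Relation.Binary.Construct.Closure.ReflexiveTransitive using (Star)
open import Induction.WellFounded using (Acc)
open import Relation.Nullary using (¬_)
open import Function.Bundles using (_⇔_)

-- Binary writing of natural numbers (most significant bit first,
-- no leading zeros; the writing of 0 is "0").

data Bit : Set where
  b0 b1 : Bit

incLSB : List Bit → List Bit
incLSB [] = b1 ∷ []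
incLSB (b0 ∷ xs) = b1 ∷ xs
incLSB (b1 ∷ xs) = b0 ∷ incLSB xs

lsbBits : ℕ → List Bit
lsbBits zero = []
lsbBits (suc n) = incLSB (lsbBits n)

binary : ℕ → List Bit
binary zero = b0 ∷ []
binary (suc n) = reverse (lsbBits (suc n))

nth : ∀ {A : Set} → List A → ℕ → Maybe A
nth [] _ = nothing
nth (x ∷ xs) zero = just x
nth (x ∷ xs) (suc i) = nth xs i

data Sym : Set where
  bit  : Bit → Sym
  lend : Sym
  rend : Sym

data Dir : Set where
  left stay right : Dir

-- S = Fin nStates (finite), F given by its characteristic function,
-- σ ⊆ (S × Sym^k) × (S × Dir^k) given by its characteristic function.
record TwoNDFA (k : ℕ) : Set where
  field
    nStates : ℕ
    s₀      : Fin nStates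
    F       : Fin nStates → Bool
    σ       : Fin nStates → Vec Sym k → Fin nStates → Vec Dir k → Bool
    noLeftOf▷  : ∀ q r q' d → σ q r q' d ≡ true →
                 ∀ i → lookup r i ≡ lend → lookup d i ≢ left
    noRightOf◁ : ∀ q r q' d → σ q r q' d ≡ true →
                 ∀ i → lookup r i ≡ rend → lookup d i ≢ right

open TwoNDFA public

-- tape ▷ w ◁ : position 0 is ▷, positions 1..|w| are w, |w|+1 is ◁
readTape : List Bit → ℕ → Sym
readTape w zero = lend
readTape w (suc i) with nth w i
... | just b  = bit b
... | nothing = rend

moveHead : Dir → ℕ → ℕ
moveHead left  p = p ∸ 1
moveHead stay  p = p
moveHead right p = suc p

Config2 : ∀ {k} → TwoNDFA k → Set
Config2 {k} M = Fin (nStates M) × Vec ℕ k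

init2 : ∀ {k} (M : TwoNDFA k) → Config2 M
init2 M = s₀ M , replicate _ 0

Step2 : ∀ {k} (M : TwoNDFA k) → List Bit → Config2 M → Config2 M → Set
Step2 {k} M w (q , ps) (q' , ps') =
  Σ (Vec Dir k) λ d →
    σ M q (map (readTape w) ps) q' d ≡ true × ps' ≡ zipWith moveHead d ps

Accepts2 : ∀ {k} → TwoNDFA k → ℕ → Set
Accepts2 M n = ∃ λ c → Star (Step2 M (binary n)) (init2 M) c × F M (proj₁ c) ≡ true

coL : ∀ {k} → TwoNDFA k → ℕ → Set
coL M n = ¬ Accepts2 M n

-- always halts: on every input, every branch of computation is finite
-- (accessibility of the initial configuration for the successor relation)
AlwaysHalts : ∀ {k} → TwoNDFA k → Set
AlwaysHalts M = ∀ n → Acc (λ c' c → Step2 M (binary n) c c') (init2 M)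

IsDeterministic2 : ∀ {k} → TwoNDFA k → Set
IsDeterministic2 M = ∀ q r q₁ d₁ q₂ d₂ →
  σ M q r q₁ d₁ ≡ true → σ M q r q₂ d₂ ≡ true → (q₁ ≡ q₂ × d₁ ≡ d₂)

data PSym : Set where
  pbit : Bit → PSym
  star : PSym

data Instr : Set where
  plus minus eps : Instr

data Outcome (p nQ : ℕ) : Set where
  go     : Vec Instr p → Fin nQ → Outcome p nQ
  accept : Outcome p nQ
  reject : Outcome p nQ

-- Q = Fin nQ ; → ⊆ (Σ^p × Q) × ((I^p × Q) ∪ {accept, reject}), total
record NDPM (p : ℕ) : Set where
  field
    nQ    : ℕ
    rel   : Vec PSym p → Fin nQ → Outcome p nQ → Bool
    total : ∀ m q → ∃ λ o → rel m q o ≡ true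

open NDPM public

IsDeterministicPM : ∀ {p} → NDPM p → Set
IsDeterministicPM M = ∀ m q o o' → rel M m q o ≡ true → rel M m q o' ≡ true → o ≡ o'

-- circular tape ⋆ a₁ … a_k of length |w|+1
readCirc : List Bit → ℕ → PSym
readCirc w zero = star
readCirc w (suc i) with nth w i
... | just b  = pbit b
... | nothing = star

movePtr : List Bit → Instr → ℕ → ℕ
movePtr w plus  a = suc a % suc (length w)
movePtr w minus a = (a + length w) % suc (length w)
movePtr w eps   a = a

newSlot : List Bit → Instr → PSym → ℕ → PSym
newSlot w eps   old a = old
newSlot w plus  old a = readCirc w a
newSlot w minus old a = readCirc w a

record ConfigPM {p : ℕ} (M : NDPM p) : Set where
  constructor cfg
  field
    mem   : Vec PSym p
    state : Fin (nQ M)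
    addr  : Vec ℕ p

nextPM : ∀ {p} (M : NDPM p) → List Bit → ConfigPM M → Vec Instr p → Fin (nQ M) → ConfigPM M
nextPM M w (cfg m q a) ins q' =
  let a' = zipWith (movePtr w) ins a
  in cfg (zipWith (λ f x → f x) (zipWith (newSlot w) ins m) a') q' a'

-- every branch reaches accept after finitely many transitions
data AcceptsPM {p} (M : NDPM p) (w : List Bit) : ConfigPM M → Set where
  accPM : ∀ {c} →
    (rel M (ConfigPM.mem c) (ConfigPM.state c) reject ≢ true) →
    (∀ ins q' → rel M (ConfigPM.mem c) (ConfigPM.state c) (go ins q') ≡ true →
       AcceptsPM M w (nextPM M w c ins q')) →
    AcceptsPM M w c

-- run M_s(n) from pseudo-configuration s, all pointers at address 0
initPM : ∀ {p} (M : NDPM p) → Vec PSym p × Fin (nQ M) → ConfigPM M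
initPM M (m , q) = cfg m q (replicate _ 0)

DecidesPM : ∀ {p} → NDPM p → (ℕ → Set) → Set
DecidesPM M S = ∃ λ s → ∀ n → AcceptsPM M (binary n) (initPM M s) ⇔ S n

module Submission where

-- Simulation of an always-halting two-way k-head automaton M by a pointer
-- machine with the same number k of pointers (so c = 0) deciding co-L(M).
--
-- Pointer i follows head i of M.  The linear tape ▷ w ◁ has cells 0 … |w|+1
-- while the circular tape ⋆ w has cells 0 … |w|: both endmarkers become the
-- single cell ⋆, and pointer i sits on the cell of head i modulo |w|+1.  To
-- tell ▷ from ◁ the simulator keeps, in its finite state, a flag per head
-- recording whether the last move of that head was to the right.  A state of
-- the simulator thus codes a state of M with k flags (an element of
-- Fin (|S| · 2^k)).  The simulator rejects on accepting states of M, follows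
-- the transitions of M, and accepts when M is stuck.

open import Defs
open import Data.Nat using (ℕ; zero; suc; _+_; _*_; _^_; _≤_; _<_; _%_; z≤n; s≤s)
open import Data.Nat.Properties using (m≤n⇒m<n∨m≡n; m≤n⇒m≤1+n; +-suc; <-irrefl; +-identityʳ)
open import Data.Nat.DivMod using (m≤n⇒m%n≡m; n%n≡0; [m+n]%n≡m%n)
open import Data.Fin using (Fin; zero; suc)
open import Data.Fin.Properties using (*↔×; 2↔Bool; any?)
open import Data.Bool using (Bool; true; false; _≟_)
open import Data.List using (List; []; _∷_; length)
open import Data.Maybe using (just; nothing)
open import Data.Vec using (Vec; []; _∷_; map; zipWith; replicate; lookup)
open import Data.Vec.Properties using (≡-dec; lookup-map; lookup-zipWith; lookup-replicate)
open import Data.Product using (Σ; ∃; ∃-syntax; _×_; _,_; proj₁; proj₂)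
open import Data.Product.Function.NonDependent.Propositional using (_×-↔_)
open import Data.Sum using (inj₁; inj₂)
open import Function using (_∘_)
open import Function.Bundles using (_↔_; Inverse; mk↔ₛ′; mk⇔)
open import Function.Properties.Inverse using (↔-refl; ↔-sym; ↔-trans)
open import Relation.Binary.PropositionalEquality
open import Relation.Binary.Construct.Closure.ReflexiveTransitive using (Star; ε; _◅_)
open import Induction.WellFounded using (Acc; acc)
open import Data.Vec.Relation.Binary.Pointwise.Extensional using (ext; Pointwise-≡⇒≡)
open import Relation.Nullary using (¬_; Dec; yes; no; does; contradiction)
open import Relation.Nullary.Decidable using (map′; _×-dec_; ¬?; dec-true)

Vec↔Fin : ∀ {A : Set} {m} k → A ↔ Fin m → Vec A k ↔ Fin (m ^ k)
Vec↔Fin zero    _ = mk↔ₛ′ (λ _ → zero) (λ _ → []) (λ { zero → refl }) (λ { [] → refl })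
Vec↔Fin {A} (suc k) e = ↔-trans uncons (↔-trans (e ×-↔ Vec↔Fin k e) (↔-sym *↔×))
  where
  uncons : Vec A (suc k) ↔ (A × Vec A k)
  uncons = mk↔ₛ′ (λ { (x ∷ xs) → x , xs }) (λ (x , xs) → x ∷ xs) (λ _ → refl) (λ { (_ ∷ _) → refl })

Dir↔Fin3 : Dir ↔ Fin 3
Dir↔Fin3 = mk↔ₛ′ (λ { left → zero ; stay → suc zero ; right → suc (suc zero) })
                  (λ { zero → left ; (suc zero) → stay ; (suc (suc zero)) → right })
                  (λ { zero → refl ; (suc zero) → refl ; (suc (suc zero)) → refl })
                  (λ { left → refl ; stay → refl ; right → refl })

∃?-finite : ∀ {A : Set} {n} → A ↔ Fin n → {P : A → Set} → (∀ a → Dec (P a)) → Dec (∃ P)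
∃?-finite e {P} P? =
  map′ (λ (i , p) → from i , p) (λ (a , p) → to a , subst P (sym (strictlyInverseʳ a)) p) (any? (P? ∘ from))
  where open Inverse e

witness : ∀ {A : Set} (a? : Dec A) → does a? ≡ true → A
witness (yes a) _ = a

nth-length : ∀ {A : Set} (w : List A) → nth w (length w) ≡ nothing
nth-length []      = refl
nth-length (_ ∷ w) = nth-length w

nth-< : ∀ {A : Set} (w : List A) i → i < length w → ∃ λ x → nth w i ≡ just x
nth-< (x ∷ w) zero    _        = x , refl
nth-< (x ∷ w) (suc i) (s≤s lt) = nth-< w i lt

inside : ∀ w i → i < length w → ∃ λ b → readTape w (suc i) ≡ bit b × readCirc w (suc i) ≡ pbit b
inside w i lt with nth w i | nth-< w i lt
... | .(just b) | b , refl = b , refl , refl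

atEnd : ∀ w → readTape w (suc (length w)) ≡ rend
atEnd w rewrite nth-length w = refl

fullTurn : ∀ L → suc L % suc L ≡ 0
fullTurn L = n%n≡0 (suc L)

stepBack : ∀ L p → p ≤ L → (suc p % suc L + L) % suc L ≡ p % suc L
stepBack L p p≤L with m≤n⇒m<n∨m≡n p≤L
... | inj₁ p<L rewrite m≤n⇒m%n≡m p<L | sym (+-suc p L) = [m+n]%n≡m%n p (suc L)
... | inj₂ refl rewrite fullTurn L = refl

-- The memory slot of a pointer reads ⋆ on both endmarkers; a flag b tells them apart
-- (b = true means "the right endmarker"), giving the symbol of M seen by that head.
symbolOf : PSym → Bool → Sym
symbolOf (pbit b) _     = bit b
symbolOf star     false = lend
symbolOf star     true  = rend

instr : Dir → Instr
instr left  = minus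
instr stay  = eps
instr right = plus

dir : Instr → Dir
dir minus = left
dir eps   = stay
dir plus  = right

dirs-instrs : ∀ {k} (d : Vec Dir k) → map dir (map instr d) ≡ d
dirs-instrs []           = refl
dirs-instrs (left  ∷ d)  = cong (left  ∷_) (dirs-instrs d)
dirs-instrs (stay  ∷ d)  = cong (stay  ∷_) (dirs-instrs d)
dirs-instrs (right ∷ d)  = cong (right ∷_) (dirs-instrs d)

instrs-dirs : ∀ {k} (ins : Vec Instr k) → map instr (map dir ins) ≡ ins
instrs-dirs []           = refl
instrs-dirs (plus  ∷ ins) = cong (plus  ∷_) (instrs-dirs ins)
instrs-dirs (minus ∷ ins) = cong (minus ∷_) (instrs-dirs ins)
instrs-dirs (eps   ∷ ins) = cong (eps   ∷_) (instrs-dirs ins)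

-- The flag after a move: leaving to the left can only reach ▷, to the right only ◁.
flagAfter : Dir → Bool → Bool
flagAfter left  _ = false
flagAfter stay  b = b
flagAfter right _ = true

-- How a pointer (address a, slot s) with flag b tracks a head at position p of ▷ w ◁:
-- it sits on the same cell of the circular tape ⋆ w, whose content its slot holds,
-- and the flag is correct whenever the head is on an endmarker.
record HeadInv (w : List Bit) (p a : ℕ) (s : PSym) (b : Bool) : Set where
  constructor headInv
  field
    onTape   : p ≤ suc (length w)
    address  : a ≡ p % suc (length w)
    slot     : s ≡ readCirc w a
    atLeft   : p ≡ 0 → b ≡ false
    atRight  : p ≡ suc (length w) → b ≡ true

HeadInv-cong : ∀ {w p p′ a a′ s s′ b b′} → p ≡ p′ → a ≡ a′ → s ≡ s′ → b ≡ b′ →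
  HeadInv w p a s b → HeadInv w p′ a′ s′ b′
HeadInv-cong refl refl refl refl h = h

symbolOf-correct : ∀ {w p a s b} → HeadInv w p a s b → symbolOf s b ≡ readTape w p
symbolOf-correct {p = zero} (headInv _ refl refl atLeft _) rewrite atLeft refl = refl
symbolOf-correct {w} {p = suc i} (headInv (s≤s i≤L) refl refl _ atRight) with m≤n⇒m<n∨m≡n i≤L
... | inj₁ i<L rewrite m≤n⇒m%n≡m i<L with inside w i i<L
...   | _ , onLine , onCircle rewrite onLine | onCircle = refl
symbolOf-correct {w} {p = suc i} (headInv (s≤s i≤L) refl refl _ atRight) | inj₂ refl
  rewrite fullTurn (length w) | atRight refl | atEnd w = refl

HeadInv-step : ∀ {w p a s b} ι → HeadInv w p a s b →
  (readTape w p ≡ lend → dir ι ≢ left) → (readTape w p ≡ rend → dir ι ≢ right) →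
  HeadInv w (moveHead (dir ι) p) (movePtr w ι a) (newSlot w ι s (movePtr w ι a)) (flagAfter (dir ι) b)
HeadInv-step eps h _ _ = h
HeadInv-step {p = zero} minus _ notLeft _ = contradiction refl (notLeft refl)
HeadInv-step {w} {p = suc p} minus (headInv (s≤s p≤L) refl _ _ _) _ _ =
  headInv (m≤n⇒m≤1+n p≤L) (stepBack (length w) p p≤L) refl (λ _ → refl)
          (λ { refl → contradiction p≤L (<-irrefl refl) })
HeadInv-step {w} {p} plus (headInv p≤1+L refl _ _ _) _ notRight with m≤n⇒m<n∨m≡n p≤1+L
... | inj₂ refl = contradiction refl (notRight (atEnd w))
... | inj₁ (s≤s p≤L) rewrite m≤n⇒m%n≡m p≤L = headInv (s≤s p≤L) refl refl (λ ()) (λ _ → refl)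

module Simulation {k : ℕ} (M : TwoNDFA k) where

  Code : Set
  Code = Fin (nStates M * 2 ^ k)

  code : (Fin (nStates M) × Vec Bool k) ↔ Code
  code = ↔-trans (↔-refl ×-↔ Vec↔Fin k (↔-sym 2↔Bool)) (↔-sym *↔×)

  open Inverse code using (to; from; strictlyInverseˡ; strictlyInverseʳ)

  stateOf : Code → Fin (nStates M)
  stateOf = proj₁ ∘ from

  flagsOf : Code → Vec Bool k
  flagsOf = proj₂ ∘ from

  seen : Vec PSym k → Code → Vec Sym k
  seen m c = zipWith symbolOf m (flagsOf c)

  Move : Vec PSym k → Code → Vec Instr k → Code → Set
  Move m c ins c′ = F M (stateOf c) ≡ false
    × σ M (stateOf c) (seen m c) (stateOf c′) (map dir ins) ≡ true
    × flagsOf c′ ≡ zipWith flagAfter (map dir ins) (flagsOf c)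

  move? : ∀ m c ins c′ → Dec (Move m c ins c′)
  move? m c ins c′ = F M (stateOf c) ≟ false
    ×-dec σ M (stateOf c) (seen m c) (stateOf c′) (map dir ins) ≟ true
    ×-dec ≡-dec _≟_ (flagsOf c′) (zipWith flagAfter (map dir ins) (flagsOf c))

  CanStep : Vec PSym k → Code → Set
  CanStep m c = ∃[ q′ ] ∃[ d ] σ M (stateOf c) (seen m c) q′ d ≡ true

  canStep? : ∀ m c → Dec (CanStep m c)
  canStep? m c = any? λ q′ → ∃?-finite (Vec↔Fin k Dir↔Fin3) λ d → σ M (stateOf c) (seen m c) q′ d ≟ true

  Halted : Vec PSym k → Code → Set
  Halted m c = F M (stateOf c) ≡ false × ¬ CanStep m c

  halted? : ∀ m c → Dec (Halted m c)
  halted? m c = F M (stateOf c) ≟ false ×-dec ¬? (canStep? m c)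

  transition : Vec PSym k → Code → Outcome k (nStates M * 2 ^ k) → Bool
  transition m c reject       = F M (stateOf c)
  transition m c accept       = does (halted? m c)
  transition m c (go ins c′)  = does (move? m c ins c′)

  move-from-step : ∀ m c q′ d → F M (stateOf c) ≡ false → σ M (stateOf c) (seen m c) q′ d ≡ true →
    Move m c (map instr d) (to (q′ , zipWith flagAfter d (flagsOf c)))
  move-from-step m c q′ d notFinal st = notFinal , enabled , flags
    where
    next : Fin (nStates M) × Vec Bool k
    next = q′ , zipWith flagAfter d (flagsOf c)
    decoded : from (to next) ≡ next
    decoded = strictlyInverseʳ next
    enabled : σ M (stateOf c) (seen m c) (stateOf (to next)) (map dir (map instr d)) ≡ true
    enabled = subst₂ (λ q″ d′ → σ M (stateOf c) (seen m c) q″ d′ ≡ true)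
                     (sym (cong proj₁ decoded)) (sym (dirs-instrs d)) st
    flags : flagsOf (to next) ≡ zipWith flagAfter (map dir (map instr d)) (flagsOf c)
    flags = trans (cong proj₂ decoded) (cong (λ d′ → zipWith flagAfter d′ (flagsOf c)) (sym (dirs-instrs d)))

  transition-total : ∀ m c → ∃ λ o → transition m c o ≡ true
  transition-total m c with F M (stateOf c) in isFinal
  ... | true = reject , isFinal
  ... | false with canStep? m c
  ...   | yes (q′ , d , st) = go _ _ , dec-true (move? m c _ _) (move-from-step m c q′ d isFinal st)
  ...   | no stuck = accept , dec-true (halted? m c) (isFinal , stuck)

  simulator : NDPM k
  simulator = record { nQ = nStates M * 2 ^ k ; rel = transition ; total = transition-total }

  Represents : List Bit → ConfigPM simulator → Config2 M → Set
  Represents w (cfg m c a) (q , ps) = stateOf c ≡ q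
    × (∀ i → HeadInv w (lookup ps i) (lookup a i) (lookup m i) (lookup (flagsOf c) i))

  seen-correct : ∀ {w m c a q ps} → Represents w (cfg m c a) (q , ps) → seen m c ≡ map (readTape w) ps
  seen-correct {w} {m} {c} {ps = ps} (_ , heads) = Pointwise-≡⇒≡ (ext λ i → begin
    lookup (zipWith symbolOf m (flagsOf c)) i  ≡⟨ lookup-zipWith symbolOf i m (flagsOf c) ⟩
    symbolOf (lookup m i) (lookup (flagsOf c) i) ≡⟨ symbolOf-correct (heads i) ⟩
    readTape w (lookup ps i)                     ≡⟨ lookup-map i (readTape w) ps ⟨
    lookup (map (readTape w) ps) i               ∎)
    where open ≡-Reasoning

  same-transitions : ∀ {w m c a q ps} → Represents w (cfg m c a) (q , ps) →
    ∀ q′ d → σ M (stateOf c) (seen m c) q′ d ≡ σ M q (map (readTape w) ps) q′ d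
  same-transitions {a = a} rep@(refl , _) q′ d = cong (λ r → σ M _ r q′ d) (seen-correct {a = a} rep)

  Represents-step : ∀ {w m c a q ps q′ c′ ins d} → Represents w (cfg m c a) (q , ps) →
    σ M q (map (readTape w) ps) q′ d ≡ true → d ≡ map dir ins →
    stateOf c′ ≡ q′ → flagsOf c′ ≡ zipWith flagAfter d (flagsOf c) →
    Represents w (nextPM simulator w (cfg m c a) ins c′) (q′ , zipWith moveHead d ps)
  Represents-step {w} {m} {c} {a} {q} {ps} {q′} {c′} {ins} (_ , heads) st refl state′ flags′ = state′ , head′
    where
    a′ : Vec ℕ k
    a′ = zipWith (movePtr w) ins a
    address′ : ∀ i → lookup a′ i ≡ movePtr w (lookup ins i) (lookup a i)
    address′ i = lookup-zipWith (movePtr w) i ins a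
    head′ : ∀ i → HeadInv w (lookup (zipWith moveHead (map dir ins) ps) i) (lookup a′ i)
                  (lookup (zipWith (λ f x → f x) (zipWith (newSlot w) ins m) a′) i) (lookup (flagsOf c′) i)
    head′ i = HeadInv-cong
      (sym (trans (lookup-zipWith moveHead i (map dir ins) ps)
                  (cong (λ δ → moveHead δ (lookup ps i)) (lookup-map i dir ins))))
      (sym (address′ i))
      (sym (trans (lookup-zipWith (λ f x → f x) i (zipWith (newSlot w) ins m) a′)
                  (cong₂ (λ f x → f x) (lookup-zipWith (newSlot w) i ins m) (address′ i))))
      (sym (trans (cong (λ fs → lookup fs i) flags′)
                  (trans (lookup-zipWith flagAfter i (map dir ins) (flagsOf c))
                         (cong (λ δ → flagAfter δ (lookup (flagsOf c) i)) (lookup-map i dir ins)))))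
      (HeadInv-step (lookup ins i) (heads i) (boundary (noLeftOf▷ M)) (boundary (noRightOf◁ M)))
      where
      reads : lookup (map (readTape w) ps) i ≡ readTape w (lookup ps i)
      reads = lookup-map i (readTape w) ps
      moves : lookup (map dir ins) i ≡ dir (lookup ins i)
      moves = lookup-map i dir ins
      boundary : ∀ {e δ} → (∀ q r q″ d → σ M q r q″ d ≡ true → ∀ i → lookup r i ≡ e → lookup d i ≢ δ) →
                 readTape w (lookup ps i) ≡ e → dir (lookup ins i) ≢ δ
      boundary never onEnd towards = never q _ q′ _ st i (trans reads onEnd) (trans moves towards)

  Reach : List Bit → Config2 M → Set
  Reach w c₂ = ∃ λ c₃ → Star (Step2 M w) c₂ c₃ × F M (proj₁ c₃) ≡ true

  sound : ∀ {w m c a q ps} → Represents w (cfg m c a) (q , ps) →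
    AcceptsPM simulator w (cfg m c a) → ¬ Reach w (q , ps)
  sound rep@(state≡ , _) (accPM noReject _) (_ , ε , final) =
    noReject (trans (cong (F M) state≡) final)
  sound {w} {m} {c} {a} {q} {ps} rep@(state≡ , _) (accPM noReject next) (c₃ , _◅_ {j = q′ , _} (d , st , refl) rest , final)
    with F M q in isFinal
  ... | true  = noReject (trans (cong (F M) state≡) isFinal)
  ... | false = sound rep′ (next (map instr d) c′ (dec-true (move? m c _ _) moves)) (c₃ , rest , final)
    where
    c′ : Code
    c′ = to (q′ , zipWith flagAfter d (flagsOf c))
    moves : Move m c (map instr d) c′
    moves = move-from-step m c q′ d (trans (cong (F M) state≡) isFinal)
                           (trans (same-transitions {a = a} rep q′ d) st)
    rep′ : Represents w (nextPM simulator w (cfg m c a) (map instr d) c′) (q′ , zipWith moveHead d ps)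
    rep′ = Represents-step rep st (sym (dirs-instrs d))
             (cong proj₁ (strictlyInverseʳ _)) (cong proj₂ (strictlyInverseʳ _))

  complete : ∀ {w m c a q ps} → Acc (λ c′ c → Step2 M w c c′) (q , ps) → ¬ Reach w (q , ps) →
    Represents w (cfg m c a) (q , ps) → AcceptsPM simulator w (cfg m c a)
  complete {w} {m} {c} {a} {q} {ps} (acc later) unreachable rep@(state≡ , _) =
    accPM (λ rejects → unreachable (_ , ε , trans (cong (F M) (sym state≡)) rejects)) continue
    where
    continue : ∀ ins c′ → transition m c (go ins c′) ≡ true →
               AcceptsPM simulator w (nextPM simulator w (cfg m c a) ins c′)
    continue ins c′ enabled =
      complete (later step) (λ (c₃ , run , final) → unreachable (c₃ , step ◅ run , final))
               (Represents-step rep st refl refl flags′)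
      where
      moves : Move m c ins c′
      moves = witness (move? m c ins c′) enabled
      flags′ : flagsOf c′ ≡ zipWith flagAfter (map dir ins) (flagsOf c)
      flags′ = proj₂ (proj₂ moves)
      st : σ M q (map (readTape w) ps) (stateOf c′) (map dir ins) ≡ true
      st = trans (sym (same-transitions {a = a} rep (stateOf c′) (map dir ins))) (proj₁ (proj₂ moves))
      step : Step2 M w (q , ps) (stateOf c′ , zipWith moveHead (map dir ins) ps)
      step = map dir ins , st , refl

  initial : Vec PSym k × Code
  initial = replicate k star , to (s₀ M , replicate k false)

  represents-initial : ∀ w → Represents w (initPM simulator initial) (init2 M)
  represents-initial w = cong proj₁ decoded , λ i →
    subst (λ fs → HeadInv w (lookup (replicate k 0) i) (lookup (replicate k 0) i)
                          (lookup (replicate k star) i) (lookup fs i))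
          (sym (cong proj₂ decoded)) (atStart i)
    where
    decoded : from (to (s₀ M , replicate k false)) ≡ (s₀ M , replicate k false)
    decoded = strictlyInverseʳ _
    atStart : ∀ i → HeadInv w (lookup (replicate k 0) i) (lookup (replicate k 0) i)
                     (lookup (replicate k star) i) (lookup (replicate k false) i)
    atStart i rewrite lookup-replicate i 0 | lookup-replicate i star | lookup-replicate i false =
      headInv z≤n refl refl (λ _ → refl) (λ ())

  decides : AlwaysHalts M → DecidesPM simulator (coL M)
  decides halts = initial , λ n → mk⇔
    (sound (represents-initial (binary n)))
    (λ rejected → complete (halts n) rejected (represents-initial (binary n)))

  deterministic : IsDeterministic2 M → IsDeterministicPM simulator
  deterministic det m c = agree
    where
    stuck : transition m c accept ≡ true → Halted m c
    stuck = witness (halted? m c)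
    moving : ∀ {ins c′} → transition m c (go ins c′) ≡ true → Move m c ins c′
    moving = witness (move? m c _ _)
    clash : ∀ {b : Bool} → b ≡ true → b ≡ false → ∀ {A : Set} → A
    clash refl ()
    agree : ∀ o o′ → transition m c o ≡ true → transition m c o′ ≡ true → o ≡ o′
    agree reject     reject     _ _ = refl
    agree accept     accept     _ _ = refl
    agree reject     accept     r h = clash r (proj₁ (stuck h))
    agree accept     reject     h r = clash r (proj₁ (stuck h))
    agree reject     (go _ _)   r g = clash r (proj₁ (moving g))
    agree (go _ _)   reject     g r = clash r (proj₁ (moving g))
    agree accept     (go _ c′)  h g = contradiction (_ , _ , proj₁ (proj₂ (moving g))) (proj₂ (stuck h))
    agree (go _ c′)  accept     g h = contradiction (_ , _ , proj₁ (proj₂ (moving g))) (proj₂ (stuck h))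
    agree (go ins₁ c₁) (go ins₂ c₂) g₁ g₂ with moving g₁ | moving g₂
    ... | _ , st₁ , flags₁ | _ , st₂ , flags₂ with det _ _ _ _ _ _ st₁ st₂
    ... | sameState , sameDirs = cong₂ go sameInstrs sameCode
      where
      sameInstrs : ins₁ ≡ ins₂
      sameInstrs = trans (sym (instrs-dirs ins₁)) (trans (cong (map instr) sameDirs) (instrs-dirs ins₂))
      sameFlags : flagsOf c₁ ≡ flagsOf c₂
      sameFlags = trans flags₁ (trans (cong (λ d → zipWith flagAfter d (flagsOf c)) sameDirs) (sym flags₂))
      sameCode : c₁ ≡ c₂
      sameCode = trans (sym (strictlyInverseˡ c₁))
                       (trans (cong to (cong₂ _,_ sameState sameFlags)) (strictlyInverseˡ c₂))

open Simulation using (simulator; decides; deterministic)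

noExtraPointers : ∀ {k} (P : ℕ → Set) → P k → ∃ λ c → P (k + c)
noExtraPointers {k} P x = 0 , subst P (sym (+-identityʳ k)) x

mainTheorem4 : (k : ℕ) → 1 ≤ k →
    ((M : TwoNDFA k) → AlwaysHalts M →
      ∃ λ c → Σ (NDPM (k + c)) λ M' → DecidesPM M' (coL M))
    ×
    ((M : TwoNDFA k) → IsDeterministic2 M → AlwaysHalts M →
      ∃ λ c → Σ (NDPM (k + c)) λ M' → IsDeterministicPM M' × DecidesPM M' (coL M))
mainTheorem4 k _ =
    (λ M halts → noExtraPointers (λ p → Σ (NDPM p) λ M' → DecidesPM M' (coL M))
                   (simulator M , decides M halts))
  , (λ M det halts → noExtraPointers (λ p → Σ (NDPM p) λ M' → IsDeterministicPM M' × DecidesPM M' (coL M))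
                       (simulator M , deterministic M det , decides M halts))
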